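{- In the one-shuffle model with $n\ge1$ cards, with all $2^n$ outcomes equally likely, the random variables $Y_A$ and $Z_B$ are independent.
   Context: One-shuffle model. Fix an integer $n\ge 1$ (cards $1,\dots,n$ initially in increasing order). An outcome of one riffle shuffle is a pair $(t,S)$ with $t\in\{0,\dots,n\}$, $S\subseteq\{1,\dots,n\}$, $|S|=t$: first pile $A=(1,\dots,t)$, second pile $B=(t+1,\dots,n)$; the permutation $\pi$ has the elements of $A$ in increasing order at the positions of $S$ and those of $B$ in increasing order elsewhere. The $2^n$ outcomes are distinct and each has probability $2^{ -n}$. Let $h=\lceil n/2\rceil$. Guesses: $g(i)=\lfloor i/2\rfloor+1$ at position $i\le h$, $g(j)=n-\lfloor (n+1-j)/2\rfloor$ at position $j\ge h+1$. $Y_A$ is the number of positions $i\le h$ such that $\pi(i)$ belongs to the first pile $A$ and $\pi(i)=g(i)$; $Z_B$ is the number of positions $j\ge h+1$ such that $\pi(j)$ belongs to the second pile $B$ and $\pi(j)=g(j)$. -}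

module Defs where

open import Data.Bool using (Bool; true; false; if_then_else_; _∧_; not)
open import Data.Nat using (ℕ; zero; suc; _+_; _*_; _∸_; _^_; _≤ᵇ_; _≡ᵇ_; ⌊_/2⌋; ⌈_/2⌉)
open import Data.List using (List; []; _∷_; map; _++_; length; filterᵇ; take; upTo; lookup)
open import Data.Vec using (Vec; []; _∷_; toList)
open import Relation.Binary.PropositionalEquality using (_≡_)

-- An outcome (t , S) of one riffle shuffle of n cards is determined by the
-- subset S ⊆ {1..n}, encoded as its characteristic vector (entry p-1 is true
-- iff position p ∈ S); then t = |S|.
Outcome : ℕ → Set
Outcome n = Vec Bool n

allOutcomes : (n : ℕ) → List (Outcome n)
allOutcomes zero = [] ∷ []
allOutcomes (suc n) = map (true ∷_) (allOutcomes n) ++ map (false ∷_) (allOutcomes n)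

countTrue : List Bool → ℕ
countTrue [] = 0
countTrue (true ∷ xs) = suc (countTrue xs)
countTrue (false ∷ xs) = countTrue xs

countFalse : List Bool → ℕ
countFalse [] = 0
countFalse (true ∷ xs) = countFalse xs
countFalse (false ∷ xs) = suc (countFalse xs)

pileSize : ∀ {n} → Outcome n → ℕ
pileSize S = countTrue (toList S)

-- membership of the 1-based position p in S (positions outside 1..n: false)
inS : ∀ {n} → Outcome n → ℕ → Bool
inS S zero = false
inS S (suc p) = go (toList S) p
  where
  go : List Bool → ℕ → Bool
  go [] _ = false
  go (x ∷ xs) zero = x
  go (x ∷ xs) (suc k) = go xs k

-- The permutation π (value at the 1-based position p): elements of A in
-- increasing order at the positions of S, those of B = (t+1,…,n) in increasing
-- order at the other positions.
perm : ∀ {n} → Outcome n → ℕ → ℕ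
perm S p =
  if inS S p
  then countTrue (take p (toList S))
  else pileSize S + countFalse (take p (toList S))

half : ℕ → ℕ
half n = ⌈ n /2⌉

guess : ℕ → ℕ → ℕ
guess n p = if p ≤ᵇ half n then suc ⌊ p /2⌋ else n ∸ ⌊ (suc n ∸ p) /2⌋

inA : ∀ {n} → Outcome n → ℕ → Bool
inA S v = (1 ≤ᵇ v) ∧ (v ≤ᵇ pileSize S)

inB : ∀ {n} → Outcome n → ℕ → Bool
inB {n} S v = (suc (pileSize S) ≤ᵇ v) ∧ (v ≤ᵇ n)

positions : ℕ → List ℕ
positions n = map suc (upTo n)

Y-A : ∀ {n} → Outcome n → ℕ
Y-A {n} S = length (filterᵇ
  (λ i → (i ≤ᵇ half n) ∧ inA S (perm S i) ∧ (perm S i ≡ᵇ guess n i))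
  (positions n))

Z-B : ∀ {n} → Outcome n → ℕ
Z-B {n} S = length (filterᵇ
  (λ j → (suc (half n) ≤ᵇ j) ∧ inB S (perm S j) ∧ (perm S j ≡ᵇ guess n j))
  (positions n))

#outcomes : (n : ℕ) → (Outcome n → Bool) → ℕ
#outcomes n E = length (filterᵇ E (allOutcomes n))

-- Independence of two ℕ-valued random variables X, W under the uniform
-- distribution on the 2^n outcomes: for all values a, b,
--   P(X = a ∧ W = b) = P(X = a) · P(W = b),
-- i.e. (multiplying through by 2^n · 2^n)
--   2^n · #{X = a ∧ W = b} = #{X = a} · #{W = b}.
IndependentUniform : (n : ℕ) → (Outcome n → ℕ) → (Outcome n → ℕ) → Set
IndependentUniform n X W = ∀ (a b : ℕ) →
  2 ^ n * #outcomes n (λ S → (X S ≡ᵇ a) ∧ (W S ≡ᵇ b))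
    ≡ #outcomes n (λ S → X S ≡ᵇ a) * #outcomes n (λ S → W S ≡ᵇ b)

-- A card is in the first pile exactly at the positions of S: at p ∈ S it is π(p) = |S ∩ {1,…,p}|,
-- at p ∉ S it is π(p) = n − |{p+1,…,n} ∖ S|. So whether a position p ≤ h counts for Y_A depends
-- only on S ∩ {1,…,h}, whether a position p > h counts for Z_B only on S ∩ {h+1,…,n}, and the two
-- halves of a uniformly random subset are independent.
module Submission where

open import Defs
open import Data.Bool using (Bool; true; false; if_then_else_; _∧_; not; T)
open import Data.Bool.Properties using (∧-zeroʳ)
open import Data.List using (List; []; _∷_; map; _++_; length; filterᵇ; take; drop)
open import Data.List.Properties using (length-++; filter-++; take-take; drop-drop)
open import Data.List.Relation.Unary.All using (All; []; _∷_; tabulate)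
open import Data.List.Relation.Unary.All.Properties using (map⁺; applyUpTo⁺₁)
open import Data.Nat using (ℕ; zero; suc; _+_; _*_; _∸_; _^_; _≤_; _<_; _≤ᵇ_; _≡ᵇ_; _≤?_; _≟_; ⌊_/2⌋; z≤n; s≤s; s≤s⁻¹)
open import Data.Nat.Properties
open import Data.Nat.Tactic.RingSolver using (solve-∀)
open import Data.Vec using ([]; _∷_; toList)
open import Data.Vec.Properties using (length-toList)
open import Function using (_∘_; mk⇔)
open import Relation.Nullary.Decidable using (dec-true; dec-false; does-⇔)
open import Relation.Binary.PropositionalEquality

≤ᵇ≡true⇒≤ : ∀ m n → (m ≤ᵇ n) ≡ true → m ≤ n
≤ᵇ≡true⇒≤ m n e = ≤ᵇ⇒≤ m n (subst T (sym e) _)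

≤ᵇ≡false : ∀ {m n} → n < m → (m ≤ᵇ n) ≡ false
≤ᵇ≡false {m} {n} n<m = dec-false (m ≤? n) (<⇒≱ n<m)

bitAt : List Bool → ℕ → Bool
bitAt []       _       = false
bitAt (b ∷ bs) zero    = b
bitAt (b ∷ bs) (suc q) = bitAt bs q

bitAt-take : ∀ {q k} bs → q < k → bitAt (take k bs) q ≡ bitAt bs q
bitAt-take         []       (s≤s _)   = refl
bitAt-take {zero}  (b ∷ bs) (s≤s _)   = refl
bitAt-take {suc q} (b ∷ bs) (s≤s q<k) = bitAt-take bs q<k

bitAt-drop : ∀ k bs q → bitAt (drop k bs) q ≡ bitAt bs (k + q)
bitAt-drop zero    bs       q = refl
bitAt-drop (suc k) []       q = refl
bitAt-drop (suc k) (b ∷ bs) q = bitAt-drop k bs q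

countTrue-take-bit : ∀ bs q → bitAt bs q ≡ true → 0 < countTrue (take (suc q) bs)
countTrue-take-bit (true  ∷ bs) zero    _ = s≤s z≤n
countTrue-take-bit (true  ∷ bs) (suc q) _ = s≤s z≤n
countTrue-take-bit (false ∷ bs) (suc q) e = countTrue-take-bit bs q e

countFalse-take-bit : ∀ bs q → q < length bs → bitAt bs q ≡ false → 0 < countFalse (take (suc q) bs)
countFalse-take-bit (false ∷ bs) zero    _         _ = s≤s z≤n
countFalse-take-bit (false ∷ bs) (suc q) _         _ = s≤s z≤n
countFalse-take-bit (true  ∷ bs) (suc q) (s≤s q<l) e = countFalse-take-bit bs q q<l e

countTrue-take-≤ : ∀ k bs → countTrue (take k bs) ≤ countTrue bs
countTrue-take-≤ zero    bs           = z≤n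
countTrue-take-≤ (suc k) []           = z≤n
countTrue-take-≤ (suc k) (true  ∷ bs) = s≤s (countTrue-take-≤ k bs)
countTrue-take-≤ (suc k) (false ∷ bs) = countTrue-take-≤ k bs

countTrue+countFalse : ∀ bs → countTrue bs + countFalse bs ≡ length bs
countTrue+countFalse []           = refl
countTrue+countFalse (true  ∷ bs) = cong suc (countTrue+countFalse bs)
countTrue+countFalse (false ∷ bs) =
  trans (+-suc (countTrue bs) (countFalse bs)) (cong suc (countTrue+countFalse bs))

countFalse-take+drop : ∀ k bs → countFalse (take k bs) + countFalse (drop k bs) ≡ countFalse bs
countFalse-take+drop zero    bs           = refl
countFalse-take+drop (suc k) []           = refl
countFalse-take+drop (suc k) (true  ∷ bs) = countFalse-take+drop k bs
countFalse-take+drop (suc k) (false ∷ bs) = cong suc (countFalse-take+drop k bs)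

countFalse≤length : ∀ bs → countFalse bs ≤ length bs
countFalse≤length bs = subst (countFalse bs ≤_) (countTrue+countFalse bs) (m≤n+m _ _)

module _ {A : Set} where

  filterᵇ-cong : ∀ {P Q : A → Bool} {xs} → All (λ x → P x ≡ Q x) xs → filterᵇ P xs ≡ filterᵇ Q xs
  filterᵇ-cong                 []         = refl
  filterᵇ-cong {P} {Q} {x ∷ _} (eq ∷ eqs) with P x | Q x
  ... | true  | true  = cong (x ∷_) (filterᵇ-cong eqs)
  ... | false | false = filterᵇ-cong eqs

  length-filterᵇ-map : ∀ {B : Set} (P : B → Bool) (f : A → B) xs →
    length (filterᵇ P (map f xs)) ≡ length (filterᵇ (P ∘ f) xs)
  length-filterᵇ-map P f []       = refl
  length-filterᵇ-map P f (x ∷ xs) with P (f x)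
  ... | true  = cong suc (length-filterᵇ-map P f xs)
  ... | false = length-filterᵇ-map P f xs

count-positions-cong : ∀ n {P Q : ℕ → Bool} → (∀ q → q < n → P (suc q) ≡ Q (suc q)) →
  length (filterᵇ P (positions n)) ≡ length (filterᵇ Q (positions n))
count-positions-cong n P≡Q = cong length (filterᵇ-cong (map⁺ (applyUpTo⁺₁ _ n (P≡Q _))))

#outcomes-suc : ∀ n (E : Outcome (suc n) → Bool) →
  #outcomes (suc n) E ≡ #outcomes n (E ∘ (true ∷_)) + #outcomes n (E ∘ (false ∷_))
#outcomes-suc n E = begin
  length (filterᵇ E (map (true ∷_) Ω ++ map (false ∷_) Ω))
    ≡⟨ cong length (filter-++ _ (map (true ∷_) Ω) (map (false ∷_) Ω)) ⟩
  length (filterᵇ E (map (true ∷_) Ω) ++ filterᵇ E (map (false ∷_) Ω))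
    ≡⟨ length-++ (filterᵇ E (map (true ∷_) Ω)) ⟩
  length (filterᵇ E (map (true ∷_) Ω)) + length (filterᵇ E (map (false ∷_) Ω))
    ≡⟨ cong₂ _+_ (length-filterᵇ-map E (true ∷_) Ω) (length-filterᵇ-map E (false ∷_) Ω) ⟩
  #outcomes n (E ∘ (true ∷_)) + #outcomes n (E ∘ (false ∷_)) ∎
  where
  open ≡-Reasoning
  Ω = allOutcomes n

#outcomes-cong : ∀ n {E F : Outcome n → Bool} → (∀ S → E S ≡ F S) → #outcomes n E ≡ #outcomes n F
#outcomes-cong n E≡F = cong length (filterᵇ-cong {xs = allOutcomes n} (tabulate λ {S} _ → E≡F S))

#outcomes-zero : ∀ (E : Outcome 0 → Bool) → #outcomes 0 E ≡ #outcomes 0 (λ _ → E [])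
#outcomes-zero E = #outcomes-cong 0 {E} {λ _ → E []} λ { [] → refl }

#outcomes-true : ∀ n → #outcomes n (λ _ → true) ≡ 2 ^ n
#outcomes-true zero    = refl
#outcomes-true (suc n) = begin
  #outcomes (suc n) (λ _ → true)                      ≡⟨ #outcomes-suc n _ ⟩
  #outcomes n (λ _ → true) + #outcomes n (λ _ → true) ≡⟨ cong₂ _+_ (#outcomes-true n) (#outcomes-true n) ⟩
  2 ^ n + 2 ^ n                                       ≡⟨ cong (2 ^ n +_) (sym (+-identityʳ (2 ^ n))) ⟩
  2 ^ suc n                                           ∎
  where open ≡-Reasoning

#outcomes-false : ∀ n → #outcomes n (λ _ → false) ≡ 0
#outcomes-false zero    = refl
#outcomes-false (suc n) =
  trans (#outcomes-suc n _) (cong₂ _+_ (#outcomes-false n) (#outcomes-false n))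

#outcomes-const∧ : ∀ n c (E : Outcome n → Bool) →
  2 ^ n * #outcomes n (λ S → c ∧ E S) ≡ #outcomes n (λ _ → c) * #outcomes n E
#outcomes-const∧ n true  E = cong (_* #outcomes n E) (sym (#outcomes-true n))
#outcomes-const∧ n false E = begin
  2 ^ n * #outcomes n (λ _ → false) ≡⟨ cong (2 ^ n *_) (#outcomes-false n) ⟩
  2 ^ n * 0                         ≡⟨ *-zeroʳ (2 ^ n) ⟩
  0                                 ≡⟨ cong (_* #outcomes n E) (sym (#outcomes-false n)) ⟩
  #outcomes n (λ _ → false) * #outcomes n E ∎
  where open ≡-Reasoning

#outcomes-take∧drop : ∀ n k (P Q : List Bool → Bool) →
  2 ^ n * #outcomes n (λ S → P (take k (toList S)) ∧ Q (drop k (toList S)))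
    ≡ #outcomes n (λ S → P (take k (toList S))) * #outcomes n (λ S → Q (drop k (toList S)))
#outcomes-take∧drop zero    k       P Q = begin
  1 * #outcomes 0 (λ S → P (take k (toList S)) ∧ Q (drop k (toList S)))
    ≡⟨ cong (1 *_) (#outcomes-zero (λ S → P (take k (toList S)) ∧ Q (drop k (toList S)))) ⟩
  1 * #outcomes 0 (λ _ → P (take k []) ∧ Q (drop k []))
    ≡⟨ #outcomes-const∧ 0 (P (take k [])) (λ _ → Q (drop k [])) ⟩
  #outcomes 0 (λ _ → P (take k [])) * #outcomes 0 (λ _ → Q (drop k []))
    ≡⟨ sym (cong₂ _*_ (#outcomes-zero (P ∘ take k ∘ toList)) (#outcomes-zero (Q ∘ drop k ∘ toList))) ⟩
  #outcomes 0 (λ S → P (take k (toList S))) * #outcomes 0 (λ S → Q (drop k (toList S))) ∎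
  where open ≡-Reasoning
#outcomes-take∧drop (suc n) zero    P Q = #outcomes-const∧ (suc n) (P []) (Q ∘ toList)
#outcomes-take∧drop (suc n) (suc k) P Q = begin
  2 ^ suc n * #outcomes (suc n) E         ≡⟨ cong (2 ^ suc n *_) (#outcomes-suc n E) ⟩
  (2 * 2 ^ n) * (#E true + #E false)      ≡⟨ distribute (2 ^ n) (#E true) (#E false) ⟩
  2 * (2 ^ n * #E true + 2 ^ n * #E false)
    ≡⟨ cong₂ (λ x y → 2 * (x + y)) (#outcomes-take∧drop n k (P ∘ (true ∷_)) Q)
                                   (#outcomes-take∧drop n k (P ∘ (false ∷_)) Q) ⟩
  2 * (#P true * #Q + #P false * #Q)      ≡⟨ collect (#P true) (#P false) #Q ⟩
  (#P true + #P false) * (#Q + #Q)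
    ≡⟨ sym (cong₂ _*_ (#outcomes-suc n _) (#outcomes-suc n _)) ⟩
  #outcomes (suc n) (λ S → P (take (suc k) (toList S)))
    * #outcomes (suc n) (λ S → Q (drop (suc k) (toList S))) ∎
  where
  open ≡-Reasoning
  E : Outcome (suc n) → Bool
  E S = P (take (suc k) (toList S)) ∧ Q (drop (suc k) (toList S))
  #E #P : Bool → ℕ
  #E b = #outcomes n (λ S → P (b ∷ take k (toList S)) ∧ Q (drop k (toList S)))
  #P b = #outcomes n (λ S → P (b ∷ take k (toList S)))
  #Q : ℕ
  #Q = #outcomes n (λ S → Q (drop k (toList S)))
  distribute : ∀ a x y → (2 * a) * (x + y) ≡ 2 * (a * x + a * y)
  distribute = solve-∀
  collect : ∀ x y z → 2 * (x * z + y * z) ≡ (x + y) * (z + z)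
  collect = solve-∀

independent-take-drop : ∀ {n} k {X W : Outcome n → ℕ} (f g : List Bool → ℕ) →
  (∀ S → X S ≡ f (take k (toList S))) → (∀ S → W S ≡ g (drop k (toList S))) →
  IndependentUniform n X W
independent-take-drop {n} k {X} {W} f g X≡f W≡g a b = begin
  2 ^ n * #outcomes n (λ S → (X S ≡ᵇ a) ∧ (W S ≡ᵇ b))
    ≡⟨ cong (2 ^ n *_) (#outcomes-cong n λ S → cong₂ (λ x w → (x ≡ᵇ a) ∧ (w ≡ᵇ b)) (X≡f S) (W≡g S)) ⟩
  2 ^ n * #outcomes n (λ S → P (take k (toList S)) ∧ Q (drop k (toList S)))
    ≡⟨ #outcomes-take∧drop n k P Q ⟩
  #outcomes n (λ S → P (take k (toList S))) * #outcomes n (λ S → Q (drop k (toList S)))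
    ≡⟨ sym (cong₂ _*_ (#outcomes-cong n λ S → cong (_≡ᵇ a) (X≡f S))
                      (#outcomes-cong n λ S → cong (_≡ᵇ b) (W≡g S))) ⟩
  #outcomes n (λ S → X S ≡ᵇ a) * #outcomes n (λ S → W S ≡ᵇ b) ∎
  where
  open ≡-Reasoning
  P Q : List Bool → Bool
  P l = f l ≡ᵇ a
  Q r = g r ≡ᵇ b

inS-suc : ∀ {n} (S : Outcome n) q → inS S (suc q) ≡ bitAt (toList S) q
inS-suc []      q       = refl
inS-suc (b ∷ S) zero    = refl
inS-suc (b ∷ S) (suc q) = inS-suc S q

yAt : ℕ → List Bool → ℕ → Bool
yAt n l p = (p ≤ᵇ half n) ∧ bitAt l (p ∸ 1) ∧ (countTrue (take p l) ≡ᵇ suc ⌊ p /2⌋)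

-- r is read as the outcome from position h + 1 on.
zAt : ℕ → List Bool → ℕ → Bool
zAt n r p = (suc (half n) ≤ᵇ p) ∧ not (bitAt r (p ∸ suc (half n)))
  ∧ (countFalse (drop (p ∸ half n) r) ≡ᵇ ⌊ (suc n ∸ p) /2⌋)

Y-firstHalf : ℕ → List Bool → ℕ
Y-firstHalf n l = length (filterᵇ (yAt n l) (positions n))

Z-secondHalf : ℕ → List Bool → ℕ
Z-secondHalf n r = length (filterᵇ (zAt n r) (positions n))

module _ {n} (S : Outcome n) where

  private
    L : List Bool
    L = toList S

    t h : ℕ
    t = pileSize S
    h = half n

    card-at : ℕ → Bool → ℕ
    card-at q b = if b then countTrue (take (suc q) L) else t + countFalse (take (suc q) L)

  perm-in-S : ∀ q → bitAt L q ≡ true → perm S (suc q) ≡ countTrue (take (suc q) L)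
  perm-in-S q q∈S = cong (card-at q) (trans (inS-suc S q) q∈S)

  perm-out-S : ∀ q → bitAt L q ≡ false → perm S (suc q) ≡ t + countFalse (take (suc q) L)
  perm-out-S q q∉S = cong (card-at q) (trans (inS-suc S q) q∉S)

  pileSize+countFalse-take : ∀ k → t + countFalse (take k L) ≡ n ∸ countFalse (drop k L)
  pileSize+countFalse-take k = begin
    t + countFalse (take k L)                                ≡⟨ sym (m+n∸n≡m _ (countFalse (drop k L))) ⟩
    t + countFalse (take k L) + countFalse (drop k L) ∸ countFalse (drop k L)
      ≡⟨ cong (_∸ countFalse (drop k L)) total ⟩
    n ∸ countFalse (drop k L)                                ∎
    where
    open ≡-Reasoning
    total : t + countFalse (take k L) + countFalse (drop k L) ≡ n
    total = begin
      t + countFalse (take k L) + countFalse (drop k L)   ≡⟨ +-assoc t _ _ ⟩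
      t + (countFalse (take k L) + countFalse (drop k L)) ≡⟨ cong (t +_) (countFalse-take+drop k L) ⟩
      t + countFalse L                                    ≡⟨ countTrue+countFalse L ⟩
      length L                                            ≡⟨ length-toList S ⟩
      n                                                   ∎

  countFalse-drop≤n : ∀ k → countFalse (drop k L) ≤ n
  countFalse-drop≤n k = begin
    countFalse (drop k L)                             ≤⟨ m≤n+m _ (countFalse (take k L)) ⟩
    countFalse (take k L) + countFalse (drop k L)     ≡⟨ countFalse-take+drop k L ⟩
    countFalse L                                      ≤⟨ countFalse≤length L ⟩
    length L                                          ≡⟨ length-toList S ⟩
    n                                                 ∎
    where open ≤-Reasoning

  countFalse-take-out : ∀ q → q < n → bitAt L q ≡ false → t < t + countFalse (take (suc q) L)
  countFalse-take-out q q<n q∉S =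
    m<m+n t (countFalse-take-bit L q (subst (q <_) (sym (length-toList S)) q<n) q∉S)

  inA-perm : ∀ q → q < n → inA S (perm S (suc q)) ≡ bitAt L q
  inA-perm q q<n with bitAt L q in e
  ... | true  rewrite perm-in-S q e =
    cong₂ _∧_ (dec-true (1 ≤? c) (countTrue-take-bit L q e))
              (dec-true (c ≤? t) (countTrue-take-≤ (suc q) L))
    where c = countTrue (take (suc q) L)
  ... | false rewrite perm-out-S q e =
    trans (cong ((1 ≤ᵇ v) ∧_) (dec-false (v ≤? t) (<⇒≱ (countFalse-take-out q q<n e))))
          (∧-zeroʳ (1 ≤ᵇ v))
    where v = t + countFalse (take (suc q) L)

  inB-perm : ∀ q → q < n → inB S (perm S (suc q)) ≡ not (bitAt L q)
  inB-perm q q<n with bitAt L q in e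
  ... | true  rewrite perm-in-S q e =
    cong (_∧ (c ≤ᵇ n)) (dec-false (suc t ≤? c) (≤⇒≯ (countTrue-take-≤ (suc q) L)))
    where c = countTrue (take (suc q) L)
  ... | false rewrite perm-out-S q e =
    cong₂ _∧_ (dec-true (suc t ≤? v) (countFalse-take-out q q<n e))
              (dec-true (v ≤? n) (subst (_≤ n) (sym (pileSize+countFalse-take (suc q))) (m∸n≤m n D)))
    where
    v D : ℕ
    v = t + countFalse (take (suc q) L)
    D = countFalse (drop (suc q) L)

  Y-indicator : ∀ q → q < n →
    ((suc q ≤ᵇ h) ∧ inA S (perm S (suc q)) ∧ (perm S (suc q) ≡ᵇ guess n (suc q)))
      ≡ yAt n (take h L) (suc q)
  Y-indicator q q<n with suc q ≤ᵇ h in q≤ᵇh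
  ... | false = refl
  ... | true with q<h ← ≤ᵇ≡true⇒≤ (suc q) h q≤ᵇh
    rewrite inA-perm q q<n | bitAt-take {q} L q<h with bitAt L q in e
  ...   | false = refl
  ...   | true rewrite perm-in-S q e | take-take (suc q) h L | m≤n⇒m⊓n≡m q<h = refl

  Y-A-take : Y-A S ≡ Y-firstHalf n (take h L)
  Y-A-take = count-positions-cong n Y-indicator

  Z-indicator : ∀ q → q < n →
    ((suc h ≤ᵇ suc q) ∧ inB S (perm S (suc q)) ∧ (perm S (suc q) ≡ᵇ guess n (suc q)))
      ≡ zAt n (drop h L) (suc q)
  Z-indicator q q<n with suc h ≤ᵇ suc q in h≤ᵇq
  ... | false = refl
  ... | true with h≤q ← s≤s⁻¹ (≤ᵇ≡true⇒≤ (suc h) (suc q) h≤ᵇq)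
    rewrite ≤ᵇ≡false {suc q} {h} (s≤s h≤q) | inB-perm q q<n
          | bitAt-drop h L (q ∸ h) | m+[n∸m]≡n h≤q
          | drop-drop h (suc q ∸ h) L | m+[n∸m]≡n (m≤n⇒m≤1+n h≤q)
    with bitAt L q in e
  ...   | true  = refl
  ...   | false rewrite perm-out-S q e | pileSize+countFalse-take (suc q) =
    does-⇔ (mk⇔ (∸-cancelˡ-≡ (countFalse-drop≤n (suc q)) k≤n) (cong (n ∸_)))
           (n ∸ D ≟ n ∸ k) (D ≟ k)
    where
    D k : ℕ
    D = countFalse (drop (suc q) L)
    k = ⌊ (n ∸ q) /2⌋
    k≤n : k ≤ n
    k≤n = ≤-trans (⌊n/2⌋≤n (n ∸ q)) (m∸n≤m n q)

  Z-B-drop : Z-B S ≡ Z-secondHalf n (drop h L)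
  Z-B-drop = count-positions-cong n Z-indicator

corollary3 : ∀ (n : ℕ) → 1 ≤ n → IndependentUniform n Y-A Z-B
corollary3 n _ = independent-take-drop {n} (half n) (Y-firstHalf n) (Z-secondHalf n) Y-A-take Z-B-drop
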